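{- Let $\alpha,\beta>0$, let $g(n)=\sum_{i=0}^kc_in^i$ with $k\ge0$ and $c_k\neq0$, and let $x$ be a sequence with given $x(1)$ satisfying $x(n)=\alpha x(\lfloor n/2\rfloor)+\beta x(\lceil n/2\rceil)+g(n)$ for all $n\ge2$. Set $x(0)\coloneqq0$, $h(n)\coloneqq x(n+1)-x(n)$ for $n\ge0$, $d_0\coloneqq(1-\beta)x(1)-g(1)+g(0)$, $d_1\coloneqq g(1)-(1-\beta)x(1)$. For $0\le i,j<k$ set $$b_{0j}\coloneqq\sum_{i=j+1}^k\binom ij2^jc_i,\quad b_{1j}\coloneqq\sum_{i=j+1}^k\binom ij(2^i-2^j)c_i,\quad a_{0ij}\coloneqq[j=i]\,2^i,\quad a_{1ij}\coloneqq\binom ij2^j,$$ and for $r\in\{0,1\}$ let $b_r\coloneqq(b_{r(k-1)},\dots,b_{r0})$ (a row vector), $\widetilde A_r\coloneqq(a_{rij})$ with rows indexed by $i=k-1,\dots,0$ and columns by $j=k-1,\dots,0$, $\mu_0\coloneqq\beta$, $\mu_1\coloneqq\alpha$, and $$A_r\coloneqq\begin{pmatrix}\mu_r&b_r&d_r\\0&\widetilde A_r&0\\0&0&[r=0]\end{pmatrix}\in\mathbb{C}^{(k+2)\times(k+2)}.$$ Let $u\coloneqq(1,0,\dots,0)\in\mathbb{C}^{1\times(k+2)}$ and $w\coloneqq(x(1),0,\dots,0,1,1)^\top\in\mathbb{C}^{(k+2)\times1}$ if $k\ge1$, $w\coloneqq(x(1),1)^\top$ if $k=0$. Then $(u,(A_0,A_1),w)$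 is a linear representation of $h$ as a $2$-regular sequence. Furthermore, if $d_0=d_1=0$, then $(\widetilde u,(\widetilde{A}'_0,\widetilde{A}'_1),\widetilde w)$ is also a linear representation of $h$, where $\widetilde u$, $\widetilde A'_r$ and $\widetilde w$ arise from $u$, $A_r$ and $w$ by deleting the last column, the last row and column, and the last row, respectively.
   Context: Iverson's convention: $[S]=1$ if the statement $S$ is true and $0$ otherwise. A sequence $y\in\mathbb{C}^{\mathbb{N}_0}$ is $2$-regular with linear representation $(u,(A_0,A_1),w)$ ($A_0,A_1$ square $D\times D$ matrices, $u\in\mathbb{C}^{1\times D}$, $w\in\mathbb{C}^{D\times1}$) if there is a sequence $v\colon\mathbb{N}_0\to\mathbb{C}^{D\times1}$ with $v(0)=w$, $y(n)=u\,v(n)$ for all $n\ge0$, and $v(2n+r)=A_rv(n)$ for all $n\ge0$ and $r\in\{0,1\}$. When $k=0$, the blocks $b_r$ and $\widetilde A_r$ are empty. -}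

module Defs where

open import Level using (_⊔_)
open import Algebra.Bundles using (CommutativeRing)
open import Data.Nat as ℕ using (ℕ; zero; suc; _∸_; _≟_)
open import Data.Nat.Combinatorics using (_C_)
open import Data.Fin using (Fin; toℕ; inject₁)
open import Data.Product using (Σ; _×_)
open import Relation.Nullary using (yes; no)

-- Everything is parametrised by a commutative ring R (the paper uses ℂ).
module Setup {c ℓ} (R : CommutativeRing c ℓ) where
  open CommutativeRing R

  infixl 6 _−_
  _−_ : Carrier → Carrier → Carrier
  x − y = x + (- y)

  ι : ℕ → Carrier
  ι zero = 0#
  ι (suc n) = 1# + ι n

  pow : Carrier → ℕ → Carrier
  pow x zero = 1#
  pow x (suc n) = x * pow x n

  sumℕ : ℕ → (ℕ → Carrier) → Carrier
  sumℕ zero f = 0#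
  sumℕ (suc n) f = f 0 + sumℕ n (λ t → f (suc t))

  -- sumFromTo a b f = Σ_{i=a}^{b} f i  (empty if b < a)
  sumFromTo : ℕ → ℕ → (ℕ → Carrier) → Carrier
  sumFromTo a b f = sumℕ (suc b ∸ a) (λ t → f (a ℕ.+ t))

  sumFin : ∀ n → (Fin n → Carrier) → Carrier
  sumFin zero f = 0#
  sumFin (suc n) f = f Fin.zero + sumFin n (λ i → f (Fin.suc i))
    where import Data.Fin as Fin

  Vector : ℕ → Set c
  Vector D = Fin D → Carrier

  Matrix : ℕ → Set c
  Matrix D = Fin D → Fin D → Carrier

  _·_ : ∀ {D} → Vector D → Vector D → Carrier
  _·_ {D} u v = sumFin D (λ j → u j * v j)

  _⊛_ : ∀ {D} → Matrix D → Vector D → Vector D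
  _⊛_ {D} M v = λ i → sumFin D (λ j → M i j * v j)

  _≋_ : ∀ {D} → Vector D → Vector D → Set ℓ
  v ≋ v' = ∀ i → v i ≈ v' i

  IsLinRep2 : ∀ {D} → Vector D → (Fin 2 → Matrix D) → Vector D →
              (ℕ → Carrier) → Set (c ⊔ ℓ)
  IsLinRep2 {D} u A w y =
    Σ (ℕ → Vector D) λ v →
      (v 0 ≋ w) ×
      (∀ n → y n ≈ u · v n) ×
      (∀ n (r : Fin 2) → v (2 ℕ.* n ℕ.+ toℕ r) ≋ (A r ⊛ v n))

  poly : ℕ → (ℕ → Carrier) → ℕ → Carrier
  poly k cs n = sumFromTo 0 k (λ i → cs i * pow (ι n) i)

  hseq : (ℕ → Carrier) → ℕ → Carrier
  hseq x n = x (suc n) − x n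

  two : Carrier
  two = ι 2

  iv0 : Fin 2 → Carrier
  iv0 Fin.zero = 1#
    where import Data.Fin as Fin
  iv0 (Fin.suc _) = 0#
    where import Data.Fin as Fin

  module Data3p3 (k : ℕ) (α β : Carrier) (cs : ℕ → Carrier) (x1 : Carrier) where
    open import Data.Fin using (zero; suc)

    g : ℕ → Carrier
    g = poly k cs

    d : Fin 2 → Carrier
    d zero = (1# − β) * x1 − g 1 + g 0
    d (suc _) = g 1 − (1# − β) * x1

    μ : Fin 2 → Carrier
    μ zero = β
    μ (suc _) = α

    b : Fin 2 → ℕ → Carrier
    b zero j = sumFromTo (suc j) k (λ i → ι (i C j) * pow two j * cs i)
    b (suc _) j = sumFromTo (suc j) k (λ i → ι (i C j) * (pow two i − pow two j) * cs i)

    a : Fin 2 → ℕ → ℕ → Carrier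
    a zero i j with j ≟ i
    ... | yes _ = pow two i
    ... | no _ = 0#
    a (suc _) i j = ι (i C j) * pow two j

    -- Indices of the (k+2)-dimensional space: position 0 is the first
    -- coordinate, positions 1..k correspond to i = k-1,...,0 (i = k - p),
    -- position k+1 is the last coordinate.
    entryA : Fin 2 → ℕ → ℕ → Carrier
    entryA r zero q with q ≟ suc k
    ... | yes _ = d r
    ... | no _ with q
    ...   | zero = μ r
    ...   | suc _ = b r (k ∸ q)
    entryA r (suc p) q with suc p ≟ suc k
    ... | yes _ with q ≟ suc k
    ...   | yes _ = iv0 r
    ...   | no _ = 0#
    entryA r (suc p) q | no _ with q ≟ suc k
    ...   | yes _ = 0#
    ...   | no _ with q
    ...     | zero = 0#
    ...     | suc _ = a r (k ∸ suc p) (k ∸ q)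

    A : Fin 2 → Matrix (suc (suc k))
    A r p q = entryA r (toℕ p) (toℕ q)

    u : Vector (suc (suc k))
    u p with toℕ p
    ... | zero = 1#
    ... | suc _ = 0#

    w : Vector (suc (suc k))
    w p with toℕ p
    ... | zero = x1
    ... | suc m with suc m ≟ k
    ...   | yes _ = 1#
    ...   | no _ with suc m ≟ suc k
    ...     | yes _ = 1#
    ...     | no _ = 0#

    u' : Vector (suc k)
    u' p = u (inject₁ p)

    A' : Fin 2 → Matrix (suc k)
    A' r p q = A r (inject₁ p) (inject₁ q)

    w' : Vector (suc k)
    w' p = w (inject₁ p)

-- Put x(0) = 0 and v(n) = (h(n), n^(k-1), …, n, 1, [n = 0])ᵀ; the claim is
-- v(2n + r) = A_r v(n).  Extending the recurrence to n = 0 by the corrections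
-- g(0)[n = 0] at even and d₁[n = 0] at odd arguments and subtracting
-- consecutive instances gives
--   h(2n)     = β h(n) + g(2n + 1) − g(2n)     + d₀[n = 0],
--   h(2n + 1) = α h(n) + g(2n + 2) − g(2n + 1) + d₁[n = 0].
-- By the binomial theorem (2n + r)^i = Σ_j C(i,j) 2^j r^(i-j) n^j; for r = 0, 1
-- these coefficients are the a_rij, and their consecutive differences
-- (r = 0, 1, 2) weighted by the c_i are the b_rj, the coefficient of n^k
-- cancelling.  When d₀ = d₁ = 0 the last coordinate no longer feeds the
-- others, so it can be dropped.
{-# OPTIONS --safe #-}
module Submission where

open import Defs
open import Level using (Level)
open import Algebra.Bundles using (CommutativeRing)
open import Data.Nat using (ℕ; suc; _≥_; ⌊_/2⌋; ⌈_/2⌉)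
open import Data.Fin as F using ()
open import Data.Product using (_×_; _,_)
open import Relation.Nullary using (¬_; yes; no; contradiction)
open import Relation.Binary.Definitions using (tri<; tri≈; tri>)

open import Data.Nat as ℕ using (zero; _∸_; _<_; _≤_; z≤n; s≤s; _≟_)
import Data.Nat.Properties as ℕ
open import Data.Nat.Combinatorics using (_C_; k>n⇒nCk≡0; nCn≡1)
open import Data.Fin using (Fin; toℕ)
import Data.Fin.Properties as FP
open import Function using (_∘_)
open import Data.Nat.Tactic.RingSolver using (solve-∀)
open import Data.Sum using (inj₁; inj₂)
open import Data.Maybe using (nothing)
open import Tactic.RingSolver.Core.AlmostCommutativeRing using (fromCommutativeRing)
open import Relation.Binary.PropositionalEquality as ≡ using (_≡_; _≢_)

2≤2[1+n]+r : ∀ n r → 2 ≤ 2 ℕ.* suc n ℕ.+ r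
2≤2[1+n]+r n r = ℕ.≤-trans (ℕ.*-monoʳ-≤ 2 (s≤s z≤n)) (ℕ.m≤m+n (2 ℕ.* suc n) r)

2n+0≡n+n : ∀ n → 2 ℕ.* n ℕ.+ 0 ≡ n ℕ.+ n
2n+0≡n+n = solve-∀

2n+1≡1+[n+n] : ∀ n → 2 ℕ.* n ℕ.+ 1 ≡ suc (n ℕ.+ n)
2n+1≡1+[n+n] = solve-∀

2n+2≡2[1+n]+0 : ∀ n → 2 ℕ.* n ℕ.+ 2 ≡ 2 ℕ.* suc n ℕ.+ 0
2n+2≡2[1+n]+0 = solve-∀

1+[2n+1]≡2[1+n]+0 : ∀ n → suc (2 ℕ.* n ℕ.+ 1) ≡ 2 ℕ.* suc n ℕ.+ 0
1+[2n+1]≡2[1+n]+0 = solve-∀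

⌊2n+0/2⌋≡n : ∀ n → ⌊ 2 ℕ.* n ℕ.+ 0 /2⌋ ≡ n
⌊2n+0/2⌋≡n n = ≡.trans (≡.cong ⌊_/2⌋ (2n+0≡n+n n)) (≡.sym (ℕ.n≡⌊n+n/2⌋ n))

⌈2n+0/2⌉≡n : ∀ n → ⌈ 2 ℕ.* n ℕ.+ 0 /2⌉ ≡ n
⌈2n+0/2⌉≡n n = ≡.trans (≡.cong ⌈_/2⌉ (2n+0≡n+n n)) (≡.sym (ℕ.n≡⌈n+n/2⌉ n))

⌊2n+1/2⌋≡n : ∀ n → ⌊ 2 ℕ.* n ℕ.+ 1 /2⌋ ≡ n
⌊2n+1/2⌋≡n n = ≡.trans (≡.cong ⌊_/2⌋ (2n+1≡1+[n+n] n)) (≡.sym (ℕ.n≡⌈n+n/2⌉ n))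

⌈2n+1/2⌉≡1+n : ∀ n → ⌈ 2 ℕ.* n ℕ.+ 1 /2⌉ ≡ suc n
⌈2n+1/2⌉≡1+n n = ≡.trans (≡.cong ⌈_/2⌉ (2n+1≡1+[n+n] n)) (≡.cong suc (≡.sym (ℕ.n≡⌊n+n/2⌋ n)))

module _ {c ℓ} (R : CommutativeRing c ℓ) where
  open CommutativeRing R
  open Setup R
  open import Relation.Binary.Reasoning.Setoid setoid
  open import Algebra.Properties.Semiring.Mult semiring
    using (×-homo-+; ×1-homo-*; ×-assoc-*; ×-congʳ) renaming (_×_ to _×ₙ_)
  open import Algebra.Properties.Semiring.Exp semiring using (_^_; ^-congˡ; ^-homo-*)
  open import Algebra.Properties.CommutativeSemiring.Exp commutativeSemiring using (^-distrib-*)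
  import Algebra.Properties.CommutativeSemiring.Binomial commutativeSemiring as Binomial
  open import Algebra.Properties.Semiring.Sum semiring
    using (sum; sum-cong-≋; sum-init-last; sum-replicate-zero)
  open import Algebra.Properties.AbelianGroup +-abelianGroup
    using (⁻¹-∙-comm; ⁻¹-anti-homo‿-; //-rightDividesˡ; //-rightDividesʳ)
  open import Algebra.Properties.CommutativeSemigroup +-commutativeSemigroup using (interchange)
  open import Algebra.Properties.Ring ring using (-0#≈0#; x[y-z]≈xy-xz; [y-z]x≈yx-zx)
  open import Tactic.RingSolver.NonReflective (fromCommutativeRing R (λ _ → nothing))
    using (solve; _⊜_; _⊗_)

  ι≡×1# : ∀ n → ι n ≡ n ×ₙ 1#
  ι≡×1# zero = ≡.refl
  ι≡×1# (suc n) = ≡.cong (1# +_) (ι≡×1# n)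

  ι-homo-+ : ∀ m n → ι (m ℕ.+ n) ≈ ι m + ι n
  ι-homo-+ m n rewrite ι≡×1# (m ℕ.+ n) | ι≡×1# m | ι≡×1# n = ×-homo-+ 1# m n

  ι-homo-* : ∀ m n → ι (m ℕ.* n) ≈ ι m * ι n
  ι-homo-* m n rewrite ι≡×1# (m ℕ.* n) | ι≡×1# m | ι≡×1# n = ×1-homo-* m n

  ι*≈× : ∀ n x → ι n * x ≈ n ×ₙ x
  ι*≈× n x rewrite ι≡×1# n = trans (×-assoc-* n 1# x) (×-congʳ n (*-identityˡ x))

  pow≡^ : ∀ x n → pow x n ≡ x ^ n
  pow≡^ x zero = ≡.refl
  pow≡^ x (suc n) = ≡.cong (x *_) (pow≡^ x n)

  pow-congˡ : ∀ {x y} n → x ≈ y → pow x n ≈ pow y n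
  pow-congˡ {x} {y} n x≈y rewrite pow≡^ x n | pow≡^ y n = ^-congˡ n x≈y

  pow-distrib-* : ∀ x y n → pow (x * y) n ≈ pow x n * pow y n
  pow-distrib-* x y n rewrite pow≡^ (x * y) n | pow≡^ x n | pow≡^ y n = ^-distrib-* x y n

  pow-homo-+ : ∀ x m n → pow x (m ℕ.+ n) ≈ pow x m * pow x n
  pow-homo-+ x m n rewrite pow≡^ x (m ℕ.+ n) | pow≡^ x m | pow≡^ x n = ^-homo-* x m n

  pow-0# : ∀ {e} → 0 < e → pow 0# e ≈ 0#
  pow-0# {suc e} _ = zeroˡ _

  pow-zeroˡ : ∀ n → pow 1# n ≈ 1#
  pow-zeroˡ zero = refl
  pow-zeroˡ (suc n) = trans (*-identityˡ _) (pow-zeroˡ n)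

  +-−-interchange : ∀ a b c d → (a + b) − (c + d) ≈ (a − c) + (b − d)
  +-−-interchange a b c d = trans (+-congˡ (sym (⁻¹-∙-comm c d))) (interchange a b (- c) (- d))

  +-−-cancelˡ : ∀ a b c → (a + b) − (a + c) ≈ b − c
  +-−-cancelˡ a b c = begin
    (a + b) − (a + c)   ≈⟨ +-−-interchange a b a c ⟩
    (a − a) + (b − c)   ≈⟨ +-congʳ (-‿inverseʳ a) ⟩
    0# + (b − c)        ≈⟨ +-identityˡ _ ⟩
    b − c               ∎

  +-−-cancelʳ : ∀ a b c → (a + c) − (b + c) ≈ a − b
  +-−-cancelʳ a b c = begin
    (a + c) − (b + c)   ≈⟨ +-−-interchange a c b c ⟩
    (a − b) + (c − c)   ≈⟨ +-congˡ (-‿inverseʳ c) ⟩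
    (a − b) + 0#        ≈⟨ +-identityʳ _ ⟩
    a − b               ∎

  −-corrected : ∀ {X X′ e e′ S S′} → X′ + e′ ≈ S′ → X + e ≈ S → X′ − X ≈ (S′ − S) + (e − e′)
  −-corrected {X} {X′} {e} {e′} {S} {S′} X′+e′≈S′ X+e≈S = begin
    X′ − X                                  ≈⟨ //-rightDividesʳ (e′ − e) (X′ − X) ⟨
    ((X′ − X) + (e′ − e)) − (e′ − e)        ≈⟨ +-congʳ (+-−-interchange X′ e′ X e) ⟨
    ((X′ + e′) − (X + e)) − (e′ − e)
      ≈⟨ +-cong (+-cong X′+e′≈S′ (-‿cong X+e≈S)) (⁻¹-anti-homo‿- e′ e) ⟩
    (S′ − S) + (e − e′)                     ∎

  -- Sums over initial segments of ℕ

  sumℕ-cong : ∀ m {f g : ℕ → Carrier} → (∀ t → t < m → f t ≈ g t) → sumℕ m f ≈ sumℕ m g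
  sumℕ-cong zero f≈g = refl
  sumℕ-cong (suc m) f≈g = +-cong (f≈g 0 (s≤s z≤n)) (sumℕ-cong m (λ t t<m → f≈g (suc t) (s≤s t<m)))

  sumℕ-zero : ∀ m {f : ℕ → Carrier} → (∀ t → t < m → f t ≈ 0#) → sumℕ m f ≈ 0#
  sumℕ-zero zero f≈0 = refl
  sumℕ-zero (suc m) f≈0 =
    trans (+-cong (f≈0 0 (s≤s z≤n)) (sumℕ-zero m (λ t t<m → f≈0 (suc t) (s≤s t<m)))) (+-identityˡ 0#)

  sumℕ-split : ∀ m n (f : ℕ → Carrier) → sumℕ (m ℕ.+ n) f ≈ sumℕ m f + sumℕ n (λ t → f (m ℕ.+ t))
  sumℕ-split zero n f = sym (+-identityˡ _)
  sumℕ-split (suc m) n f = trans (+-congˡ (sumℕ-split m n (f ∘ suc))) (sym (+-assoc _ _ _))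

  sumℕ-init-last : ∀ m (f : ℕ → Carrier) → sumℕ (suc m) f ≈ sumℕ m f + f m
  sumℕ-init-last m f = begin
    sumℕ (suc m) f                   ≡⟨ ≡.cong (λ n → sumℕ n f) (ℕ.+-comm 1 m) ⟩
    sumℕ (m ℕ.+ 1) f                 ≈⟨ sumℕ-split m 1 f ⟩
    sumℕ m f + (f (m ℕ.+ 0) + 0#)     ≈⟨ +-congˡ (+-identityʳ _) ⟩
    sumℕ m f + f (m ℕ.+ 0)            ≡⟨ ≡.cong (λ t → sumℕ m f + f t) (ℕ.+-identityʳ m) ⟩
    sumℕ m f + f m                   ∎

  sumℕ-distrib-+ : ∀ m (f g : ℕ → Carrier) → sumℕ m (λ t → f t + g t) ≈ sumℕ m f + sumℕ m g
  sumℕ-distrib-+ zero f g = sym (+-identityˡ 0#)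
  sumℕ-distrib-+ (suc m) f g =
    trans (+-congˡ (sumℕ-distrib-+ m (f ∘ suc) (g ∘ suc))) (interchange _ _ _ _)

  sumℕ-distrib-− : ∀ m (f g : ℕ → Carrier) → sumℕ m (λ t → f t − g t) ≈ sumℕ m f − sumℕ m g
  sumℕ-distrib-− zero f g = sym (trans (+-identityˡ _) -0#≈0#)
  sumℕ-distrib-− (suc m) f g =
    trans (+-congˡ (sumℕ-distrib-− m (f ∘ suc) (g ∘ suc))) (sym (+-−-interchange _ _ _ _))

  *-distribˡ-sumℕ : ∀ m x (f : ℕ → Carrier) → x * sumℕ m f ≈ sumℕ m (λ t → x * f t)
  *-distribˡ-sumℕ zero x f = zeroʳ x
  *-distribˡ-sumℕ (suc m) x f = trans (distribˡ x _ _) (+-congˡ (*-distribˡ-sumℕ m x (f ∘ suc)))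

  *-distribʳ-sumℕ : ∀ m x (f : ℕ → Carrier) → sumℕ m f * x ≈ sumℕ m (λ t → f t * x)
  *-distribʳ-sumℕ zero x f = zeroˡ x
  *-distribʳ-sumℕ (suc m) x f = trans (distribʳ x _ _) (+-congˡ (*-distribʳ-sumℕ m x (f ∘ suc)))

  sumℕ-comm : ∀ m n (f : ℕ → ℕ → Carrier) →
              sumℕ m (λ i → sumℕ n (f i)) ≈ sumℕ n (λ j → sumℕ m (λ i → f i j))
  sumℕ-comm zero n f = sym (sumℕ-zero n (λ _ _ → refl))
  sumℕ-comm (suc m) n f =
    trans (+-congˡ (sumℕ-comm m n (f ∘ suc))) (sym (sumℕ-distrib-+ n (f 0) _))

  sumℕ-reverse : ∀ m (f : ℕ → Carrier) → sumℕ m (λ t → f (m ∸ suc t)) ≈ sumℕ m f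
  sumℕ-reverse zero f = refl
  sumℕ-reverse (suc m) f = begin
    f m + sumℕ m (λ t → f (m ∸ suc t)) ≈⟨ +-congˡ (sumℕ-reverse m f) ⟩
    f m + sumℕ m f                     ≈⟨ +-comm _ _ ⟩
    sumℕ m f + f m                     ≈⟨ sumℕ-init-last m f ⟨
    sumℕ (suc m) f                     ∎

  sumℕ-fromTo : ∀ {j k} (f : ℕ → Carrier) → j ≤ k → (∀ i → i ≤ j → f i ≈ 0#) →
                sumℕ (suc k) f ≈ sumFromTo (suc j) k f
  sumℕ-fromTo {j} {k} f j≤k f≈0 = begin
    sumℕ (suc k) f                 ≡⟨ ≡.cong (λ m → sumℕ m f) (ℕ.m+[n∸m]≡n (s≤s j≤k)) ⟨
    sumℕ (suc j ℕ.+ (k ∸ j)) f     ≈⟨ sumℕ-split (suc j) (k ∸ j) f ⟩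
    sumℕ (suc j) f + sumFromTo (suc j) k f
      ≈⟨ +-congʳ (sumℕ-zero (suc j) (λ i i≤j → f≈0 i (ℕ.≤-pred i≤j))) ⟩
    0# + sumFromTo (suc j) k f     ≈⟨ +-identityˡ _ ⟩
    sumFromTo (suc j) k f          ∎

  sumℕ≡sum : ∀ m (f : ℕ → Carrier) → sumℕ m f ≡ sum {m} (f ∘ toℕ)
  sumℕ≡sum zero f = ≡.refl
  sumℕ≡sum (suc m) f = ≡.cong (f 0 +_) (sumℕ≡sum m (f ∘ suc))

  -- Linear representations

  sumFin≡sum : ∀ D (f : Vector D) → sumFin D f ≡ sum f
  sumFin≡sum zero f = ≡.refl
  sumFin≡sum (suc D) f = ≡.cong (f F.zero +_) (sumFin≡sum D (f ∘ F.suc))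

  sumFin-toℕ : ∀ D (f : ℕ → Carrier) → sumFin D (f ∘ toℕ) ≡ sumℕ D f
  sumFin-toℕ D f = ≡.trans (sumFin≡sum D (f ∘ toℕ)) (≡.sym (sumℕ≡sum D f))

  sumFin-zero : ∀ D {f : Vector D} → (∀ j → f j ≈ 0#) → sumFin D f ≈ 0#
  sumFin-zero D {f} f≈0 = begin
    sumFin D f          ≡⟨ sumFin≡sum D f ⟩
    sum f               ≈⟨ sum-cong-≋ f≈0 ⟩
    sum {D} (λ _ → 0#)  ≈⟨ sum-replicate-zero D ⟩
    0#                  ∎

  sumFin-init-last : ∀ D (f : Vector (suc D)) →
                     sumFin (suc D) f ≈ sumFin D (f ∘ F.inject₁) + f (F.fromℕ D)
  sumFin-init-last D f = begin
    sumFin (suc D) f                          ≡⟨ sumFin≡sum (suc D) f ⟩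
    sum f                                     ≈⟨ sum-init-last f ⟩
    sum (f ∘ F.inject₁) + f (F.fromℕ D)
      ≡⟨ ≡.cong (_+ f (F.fromℕ D)) (sumFin≡sum D (f ∘ F.inject₁)) ⟨
    sumFin D (f ∘ F.inject₁) + f (F.fromℕ D)  ∎

  ·-head : ∀ {D} (u v : Vector (suc D)) → u F.zero ≈ 1# → (∀ j → u (F.suc j) ≈ 0#) → u · v ≈ v F.zero
  ·-head {D} u v u₀≈1 u₊≈0 = begin
    u F.zero * v F.zero + sumFin D (λ j → u (F.suc j) * v (F.suc j))
      ≈⟨ +-cong (*-congʳ u₀≈1) (sumFin-zero D (λ j → trans (*-congʳ (u₊≈0 j)) (zeroˡ _))) ⟩
    1# * v F.zero + 0#   ≈⟨ +-identityʳ _ ⟩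
    1# * v F.zero        ≈⟨ *-identityˡ _ ⟩
    v F.zero             ∎

  IsLinRep2-dropLast : ∀ {D} {u : Vector (suc D)} {A : Fin 2 → Matrix (suc D)} {w y} →
    IsLinRep2 u A w y → u (F.fromℕ D) ≈ 0# → (∀ r p → A r (F.inject₁ p) (F.fromℕ D) ≈ 0#) →
    IsLinRep2 (u ∘ F.inject₁) (λ r p q → A r (F.inject₁ p) (F.inject₁ q)) (w ∘ F.inject₁) y
  IsLinRep2-dropLast {D} {u} {A} {y = y} (v , v0≋w , y≈uv , v-rec) u-last≈0 A-last≈0 =
    (λ n → v n ∘ F.inject₁) , v0≋w ∘ F.inject₁ , output , recurrence
    where
    dropLast : ∀ (a b : Vector (suc D)) → a (F.fromℕ D) ≈ 0# →
               sumFin (suc D) (λ j → a j * b j) ≈ sumFin D (λ j → a (F.inject₁ j) * b (F.inject₁ j))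
    dropLast a b a-last≈0 = begin
      sumFin (suc D) (λ j → a j * b j)  ≈⟨ sumFin-init-last D (λ j → a j * b j) ⟩
      sumFin D (λ j → a (F.inject₁ j) * b (F.inject₁ j)) + a (F.fromℕ D) * b (F.fromℕ D)
        ≈⟨ +-congˡ (trans (*-congʳ a-last≈0) (zeroˡ _)) ⟩
      sumFin D (λ j → a (F.inject₁ j) * b (F.inject₁ j)) + 0#  ≈⟨ +-identityʳ _ ⟩
      sumFin D (λ j → a (F.inject₁ j) * b (F.inject₁ j))  ∎
    output : ∀ n → y n ≈ (u ∘ F.inject₁) · (v n ∘ F.inject₁)
    output n = trans (y≈uv n) (dropLast u (v n) u-last≈0)
    recurrence : ∀ n r → (v (2 ℕ.* n ℕ.+ toℕ r) ∘ F.inject₁) ≋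
                         ((λ p q → A r (F.inject₁ p) (F.inject₁ q)) ⊛ (v n ∘ F.inject₁))
    recurrence n r p =
      trans (v-rec n r (F.inject₁ p)) (dropLast (A r (F.inject₁ p)) (v n) (A-last≈0 r p))

  -- Powers of 2n + r

  binomial-sumℕ : ∀ x y i m → i < m →
                  pow (x + y) i ≈ sumℕ m (λ j → ι (i C j) * (pow x j * pow y (i ∸ j)))
  binomial-sumℕ x y i m i<m = begin
    pow (x + y) i             ≡⟨ pow≡^ (x + y) i ⟩
    (x + y) ^ i               ≈⟨ Binomial.theorem i x y ⟩
    Binomial.binomialExpansion x y i ≈⟨ sum-cong-≋ {suc i} (λ j → sym (term≈ (toℕ j))) ⟩
    sum {suc i} (term ∘ toℕ)  ≡⟨ sumℕ≡sum (suc i) term ⟨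
    sumℕ (suc i) term         ≈⟨ +-identityʳ _ ⟨
    sumℕ (suc i) term + 0#    ≈⟨ +-congˡ (sumℕ-zero (m ∸ suc i) (λ t _ → vanish t)) ⟨
    sumℕ (suc i) term + sumℕ (m ∸ suc i) (λ t → term (suc i ℕ.+ t))
      ≈⟨ sumℕ-split (suc i) (m ∸ suc i) term ⟨
    sumℕ (suc i ℕ.+ (m ∸ suc i)) term ≡⟨ ≡.cong (λ n → sumℕ n term) (ℕ.m+[n∸m]≡n i<m) ⟩
    sumℕ m term               ∎
    where
    term : ℕ → Carrier
    term j = ι (i C j) * (pow x j * pow y (i ∸ j))
    term≈ : ∀ j → term j ≈ (i C j) ×ₙ (x ^ j * y ^ (i ∸ j))
    term≈ j rewrite pow≡^ x j | pow≡^ y (i ∸ j) = ι*≈× (i C j) _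
    vanish : ∀ t → term (suc i ℕ.+ t) ≈ 0#
    vanish t rewrite k>n⇒nCk≡0 {i} {suc i ℕ.+ t} (s≤s (ℕ.m≤m+n i t)) = zeroˡ _

  shiftCoeff : ℕ → ℕ → ℕ → Carrier
  shiftCoeff r i j = ι (i C j) * pow two j * pow (ι r) (i ∸ j)

  pow-2n+r : ∀ n r i m → i < m →
             pow (ι (2 ℕ.* n ℕ.+ r)) i ≈ sumℕ m (λ j → shiftCoeff r i j * pow (ι n) j)
  pow-2n+r n r i m i<m = begin
    pow (ι (2 ℕ.* n ℕ.+ r)) i  ≈⟨ pow-congˡ i (trans (ι-homo-+ (2 ℕ.* n) r) (+-congʳ (ι-homo-* 2 n))) ⟩
    pow (two * ι n + ι r) i    ≈⟨ binomial-sumℕ (two * ι n) (ι r) i m i<m ⟩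
    sumℕ m (λ j → ι (i C j) * (pow (two * ι n) j * pow (ι r) (i ∸ j)))
      ≈⟨ sumℕ-cong m (λ j _ →
           trans (*-congˡ (*-congʳ (pow-distrib-* two (ι n) j))) (rearrange _ _ _ _)) ⟩
    sumℕ m (λ j → shiftCoeff r i j * pow (ι n) j)  ∎
    where
    rearrange : ∀ c t m z → c * ((t * m) * z) ≈ ((c * t) * z) * m
    rearrange = solve 4 (λ c t m z → (c ⊗ ((t ⊗ m) ⊗ z)) ⊜ (((c ⊗ t) ⊗ z) ⊗ m)) refl

  shiftCoeff-above : ∀ r {i j} → i < j → shiftCoeff r i j ≈ 0#
  shiftCoeff-above r {i} {j} i<j rewrite k>n⇒nCk≡0 i<j = trans (*-congʳ (zeroˡ _)) (zeroˡ _)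

  shiftCoeff-diag : ∀ r i → shiftCoeff r i i ≈ pow two i
  shiftCoeff-diag r i rewrite nCn≡1 i | ℕ.n∸n≡0 i = begin
    (1# + 0#) * pow two i * 1#  ≈⟨ *-identityʳ _ ⟩
    (1# + 0#) * pow two i       ≈⟨ *-congʳ (+-identityʳ 1#) ⟩
    1# * pow two i              ≈⟨ *-identityˡ _ ⟩
    pow two i                   ∎

  shiftCoeff-0-below : ∀ {i j} → j < i → shiftCoeff 0 i j ≈ 0#
  shiftCoeff-0-below j<i = trans (*-congˡ (pow-0# (ℕ.m<n⇒0<n∸m j<i))) (zeroʳ _)

  shiftCoeff-1 : ∀ i j → shiftCoeff 1 i j ≈ ι (i C j) * pow two j
  shiftCoeff-1 i j =
    trans (*-congˡ (trans (pow-congˡ (i ∸ j) (+-identityʳ 1#)) (pow-zeroˡ (i ∸ j)))) (*-identityʳ _)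

  shiftCoeff-2 : ∀ {i j} → j ≤ i → shiftCoeff 2 i j ≈ ι (i C j) * pow two i
  shiftCoeff-2 {i} {j} j≤i = begin
    ι (i C j) * pow two j * pow two (i ∸ j)    ≈⟨ *-assoc _ _ _ ⟩
    ι (i C j) * (pow two j * pow two (i ∸ j))  ≈⟨ *-congˡ (pow-homo-+ two j (i ∸ j)) ⟨
    ι (i C j) * pow two (j ℕ.+ (i ∸ j))
      ≡⟨ ≡.cong (λ e → ι (i C j) * pow two e) (ℕ.m+[n∸m]≡n j≤i) ⟩
    ι (i C j) * pow two i                      ∎

  shiftDiff : ℕ → ℕ → ℕ → Carrier
  shiftDiff r i j = shiftCoeff (suc r) i j − shiftCoeff r i j

  shiftDiff-upper : ∀ r {i j} → i ≤ j → shiftDiff r i j ≈ 0#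
  shiftDiff-upper r {i} {j} i≤j with ℕ.m≤n⇒m<n∨m≡n i≤j
  ... | inj₁ i<j = trans (+-cong (shiftCoeff-above (suc r) i<j) (-‿cong (shiftCoeff-above r i<j)))
                         (trans (+-congˡ -0#≈0#) (+-identityʳ 0#))
  ... | inj₂ ≡.refl = trans (+-cong (shiftCoeff-diag (suc r) i) (-‿cong (shiftCoeff-diag r i)))
                            (-‿inverseʳ (pow two i))

  shiftDiff-0-below : ∀ {i j} → j < i → shiftDiff 0 i j ≈ ι (i C j) * pow two j
  shiftDiff-0-below {i} {j} j<i = begin
    shiftCoeff 1 i j − shiftCoeff 0 i j  ≈⟨ +-cong (shiftCoeff-1 i j) (-‿cong (shiftCoeff-0-below j<i)) ⟩
    ι (i C j) * pow two j − 0#          ≈⟨ +-congˡ -0#≈0# ⟩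
    ι (i C j) * pow two j + 0#          ≈⟨ +-identityʳ _ ⟩
    ι (i C j) * pow two j               ∎

  shiftDiff-1-below : ∀ {i j} → j < i → shiftDiff 1 i j ≈ ι (i C j) * (pow two i − pow two j)
  shiftDiff-1-below {i} {j} j<i = begin
    shiftCoeff 2 i j − shiftCoeff 1 i j
      ≈⟨ +-cong (shiftCoeff-2 (ℕ.<⇒≤ j<i)) (-‿cong (shiftCoeff-1 i j)) ⟩
    ι (i C j) * pow two i − ι (i C j) * pow two j  ≈⟨ x[y-z]≈xy-xz (ι (i C j)) _ _ ⟨
    ι (i C j) * (pow two i − pow two j)            ∎

  pow-difference-2n+r : ∀ n r i m → i < m →
    pow (ι (2 ℕ.* n ℕ.+ suc r)) i − pow (ι (2 ℕ.* n ℕ.+ r)) i ≈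
    sumℕ m (λ j → shiftDiff r i j * pow (ι n) j)
  pow-difference-2n+r n r i m i<m = begin
    pow (ι (2 ℕ.* n ℕ.+ suc r)) i − pow (ι (2 ℕ.* n ℕ.+ r)) i
      ≈⟨ +-cong (pow-2n+r n (suc r) i m i<m) (-‿cong (pow-2n+r n r i m i<m)) ⟩
    sumℕ m (λ j → shiftCoeff (suc r) i j * pow (ι n) j) − sumℕ m (λ j → shiftCoeff r i j * pow (ι n) j)
      ≈⟨ sumℕ-distrib-− m (λ j → shiftCoeff (suc r) i j * pow (ι n) j)
                          (λ j → shiftCoeff r i j * pow (ι n) j) ⟨
    sumℕ m (λ j → shiftCoeff (suc r) i j * pow (ι n) j − shiftCoeff r i j * pow (ι n) j)
      ≈⟨ sumℕ-cong m (λ j _ → sym ([y-z]x≈yx-zx (pow (ι n) j) _ _)) ⟩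
    sumℕ m (λ j → shiftDiff r i j * pow (ι n) j)  ∎

  poly-difference-2n+r : ∀ k cs n r →
    poly k cs (2 ℕ.* n ℕ.+ suc r) − poly k cs (2 ℕ.* n ℕ.+ r) ≈
    sumℕ (suc k) (λ j → sumℕ (suc k) (λ i → cs i * shiftDiff r i j) * pow (ι n) j)
  poly-difference-2n+r k cs n r = begin
    sumℕ (suc k) (λ i → cs i * P (suc r) i) − sumℕ (suc k) (λ i → cs i * P r i)
      ≈⟨ sumℕ-distrib-− (suc k) (λ i → cs i * P (suc r) i) (λ i → cs i * P r i) ⟨
    sumℕ (suc k) (λ i → cs i * P (suc r) i − cs i * P r i)
      ≈⟨ sumℕ-cong (suc k) (λ i i≤k →
           trans (sym (x[y-z]≈xy-xz (cs i) _ _)) (*-congˡ (pow-difference-2n+r n r i (suc k) i≤k))) ⟩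
    sumℕ (suc k) (λ i → cs i * sumℕ (suc k) (λ j → shiftDiff r i j * pow (ι n) j))
      ≈⟨ sumℕ-cong (suc k) (λ i _ →
           *-distribˡ-sumℕ (suc k) (cs i) (λ j → shiftDiff r i j * pow (ι n) j)) ⟩
    sumℕ (suc k) (λ i → sumℕ (suc k) (λ j → cs i * (shiftDiff r i j * pow (ι n) j)))
      ≈⟨ sumℕ-comm (suc k) (suc k) (λ i j → cs i * (shiftDiff r i j * pow (ι n) j)) ⟩
    sumℕ (suc k) (λ j → sumℕ (suc k) (λ i → cs i * (shiftDiff r i j * pow (ι n) j)))
      ≈⟨ sumℕ-cong (suc k) (λ j _ →
           trans (sumℕ-cong (suc k) (λ i _ → sym (*-assoc (cs i) (shiftDiff r i j) (pow (ι n) j))))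
                 (sym (*-distribʳ-sumℕ (suc k) (pow (ι n) j) (λ i → cs i * shiftDiff r i j)))) ⟩
    sumℕ (suc k) (λ j → sumℕ (suc k) (λ i → cs i * shiftDiff r i j) * pow (ι n) j)  ∎
    where
    P : ℕ → ℕ → Carrier
    P r i = pow (ι (2 ℕ.* n ℕ.+ r)) i

  -- The representation of h

  module _ (k : ℕ) (α β : Carrier) (cs : ℕ → Carrier) (x : ℕ → Carrier) where
    open Data3p3 k α β cs (x 1)

    a≈shiftCoeff : ∀ r i j → a r i j ≈ shiftCoeff (toℕ r) i j
    a≈shiftCoeff F.zero i j with j ≟ i
    ... | yes ≡.refl = sym (shiftCoeff-diag 0 i)
    ... | no j≢i with ℕ.<-cmp i j
    ...   | tri< i<j _ _ = sym (shiftCoeff-above 0 i<j)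
    ...   | tri≈ _ i≡j _ = contradiction (≡.sym i≡j) j≢i
    ...   | tri> _ _ j<i = sym (shiftCoeff-0-below j<i)
    a≈shiftCoeff (F.suc F.zero) i j = sym (shiftCoeff-1 i j)

    b≈Σ-shiftDiff : ∀ r {j} → j < k → b r j ≈ sumℕ (suc k) (λ i → cs i * shiftDiff (toℕ r) i j)
    b≈Σ-shiftDiff r {j} j<k = sym (begin
      sumℕ (suc k) (λ i → cs i * shiftDiff (toℕ r) i j)
        ≈⟨ sumℕ-fromTo _ (ℕ.<⇒≤ j<k) (λ i i≤j →
             trans (*-congˡ (shiftDiff-upper (toℕ r) i≤j)) (zeroʳ (cs i))) ⟩
      sumFromTo (suc j) k (λ i → cs i * shiftDiff (toℕ r) i j)  ≈⟨ below-diagonal r ⟩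
      b r j                                                   ∎)
      where
      j<j+1+t : ∀ t → j < suc j ℕ.+ t
      j<j+1+t t = s≤s (ℕ.m≤m+n j t)
      below-diagonal : ∀ r → sumFromTo (suc j) k (λ i → cs i * shiftDiff (toℕ r) i j) ≈ b r j
      below-diagonal F.zero =
        sumℕ-cong (k ∸ j) (λ t _ → trans (*-comm _ _) (*-congʳ (shiftDiff-0-below (j<j+1+t t))))
      below-diagonal (F.suc F.zero) =
        sumℕ-cong (k ∸ j) (λ t _ → trans (*-comm _ _) (*-congʳ (shiftDiff-1-below (j<j+1+t t))))

    g-difference : ∀ n r →
      g (2 ℕ.* n ℕ.+ suc (toℕ r)) − g (2 ℕ.* n ℕ.+ toℕ r) ≈ sumℕ k (λ j → b r j * pow (ι n) j)
    g-difference n r = begin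
      g (2 ℕ.* n ℕ.+ suc (toℕ r)) − g (2 ℕ.* n ℕ.+ toℕ r)  ≈⟨ poly-difference-2n+r k cs n (toℕ r) ⟩
      sumℕ (suc k) (λ j → B j * pow (ι n) j)             ≈⟨ sumℕ-init-last k _ ⟩
      sumℕ k (λ j → B j * pow (ι n) j) + B k * pow (ι n) k
        ≈⟨ +-congˡ (trans (*-congʳ top≈0) (zeroˡ _)) ⟩
      sumℕ k (λ j → B j * pow (ι n) j) + 0#               ≈⟨ +-identityʳ _ ⟩
      sumℕ k (λ j → B j * pow (ι n) j)
        ≈⟨ sumℕ-cong k (λ j j<k → *-congʳ (sym (b≈Σ-shiftDiff r j<k))) ⟩
      sumℕ k (λ j → b r j * pow (ι n) j)                  ∎
      where
      B : ℕ → Carrier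
      B j = sumℕ (suc k) (λ i → cs i * shiftDiff (toℕ r) i j)
      top≈0 : B k ≈ 0#
      top≈0 = sumℕ-zero (suc k) (λ i i≤k →
        trans (*-congˡ (shiftDiff-upper (toℕ r) (ℕ.≤-pred i≤k))) (zeroʳ (cs i)))

    δ₀ : ℕ → Carrier
    δ₀ zero = 1#
    δ₀ (suc _) = 0#

    coord : ℕ → ℕ → Carrier
    coord n zero = hseq x n
    coord n (suc q) with suc q ≟ suc k
    ... | yes _ = δ₀ n
    ... | no _ = pow (ι n) (k ∸ suc q)

    state : ℕ → Vector (suc (suc k))
    state n p = coord n (toℕ p)

    data Position : ℕ → Set where
      first : Position 0
      middle : ∀ {t} → t < k → Position (suc t)
      last : Position (suc k)

    position : ∀ {p} → p < suc (suc k) → Position p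
    position {zero} _ = first
    position {suc p} (s≤s (s≤s p≤k)) with ℕ.m≤n⇒m<n∨m≡n p≤k
    ... | inj₁ p<k = middle p<k
    ... | inj₂ ≡.refl = last

    1+t≢1+k : ∀ {t} → t < k → suc t ≢ suc k
    1+t≢1+k t<k ≡.refl = ℕ.<-irrefl ≡.refl t<k

    coord-middle : ∀ n {t} → t < k → coord n (suc t) ≡ pow (ι n) (k ∸ suc t)
    coord-middle n {t} t<k with suc t ≟ suc k
    ... | yes eq = contradiction eq (1+t≢1+k t<k)
    ... | no _ = ≡.refl

    coord-last : ∀ n → coord n (suc k) ≡ δ₀ n
    coord-last n with suc k ≟ suc k
    ... | yes _ = ≡.refl
    ... | no neq = contradiction ≡.refl neq

    entry-first-middle : ∀ r {t} → t < k → entryA r 0 (suc t) ≡ b r (k ∸ suc t)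
    entry-first-middle r {t} t<k with suc t ≟ suc k
    ... | yes eq = contradiction eq (1+t≢1+k t<k)
    ... | no _ = ≡.refl

    entry-first-last : ∀ r → entryA r 0 (suc k) ≡ d r
    entry-first-last r with suc k ≟ suc k
    ... | yes _ = ≡.refl
    ... | no neq = contradiction ≡.refl neq

    entry-middle-first : ∀ r {p} → p < k → entryA r (suc p) 0 ≡ 0#
    entry-middle-first r {p} p<k with suc p ≟ suc k
    ... | yes eq = contradiction eq (1+t≢1+k p<k)
    ... | no _ = ≡.refl

    entry-middle-middle : ∀ r {p t} → p < k → t < k →
                          entryA r (suc p) (suc t) ≡ a r (k ∸ suc p) (k ∸ suc t)
    entry-middle-middle r {p} {t} p<k t<k with suc p ≟ suc k
    ... | yes eq = contradiction eq (1+t≢1+k p<k)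
    ... | no _ with suc t ≟ suc k
    ...   | yes eq = contradiction eq (1+t≢1+k t<k)
    ...   | no _ = ≡.refl

    entry-middle-last : ∀ r {p} → p < k → entryA r (suc p) (suc k) ≡ 0#
    entry-middle-last r {p} p<k with suc p ≟ suc k
    ... | yes eq = contradiction eq (1+t≢1+k p<k)
    ... | no _ with suc k ≟ suc k
    ...   | yes _ = ≡.refl
    ...   | no neq = contradiction ≡.refl neq

    entry-last-first : ∀ r → entryA r (suc k) 0 ≡ 0#
    entry-last-first r with suc k ≟ suc k
    ... | yes _ = ≡.refl
    ... | no neq = contradiction ≡.refl neq

    entry-last-middle : ∀ r {t} → t < k → entryA r (suc k) (suc t) ≡ 0#
    entry-last-middle r {t} t<k with suc k ≟ suc k
    ... | no neq = contradiction ≡.refl neq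
    ... | yes _ with suc t ≟ suc k
    ...   | yes eq = contradiction eq (1+t≢1+k t<k)
    ...   | no _ = ≡.refl

    entry-last-last : ∀ r → entryA r (suc k) (suc k) ≡ iv0 r
    entry-last-last r with suc k ≟ suc k
    ... | no neq = contradiction ≡.refl neq
    ... | yes _ with suc k ≟ suc k
    ...   | yes _ = ≡.refl
    ...   | no neq = contradiction ≡.refl neq

    row-expansion : ∀ n (e ρ : ℕ → Carrier) {e-first e-last} → e 0 ≈ e-first →
      (∀ {t} → t < k → e (suc t) ≈ ρ (k ∸ suc t)) → e (suc k) ≈ e-last →
      sumℕ (suc (suc k)) (λ q → e q * coord n q) ≈
      e-first * hseq x n + sumℕ k (λ j → ρ j * pow (ι n) j) + e-last * δ₀ n
    row-expansion n e ρ {e-first} {e-last} e₀≈ e-middle≈ e-last≈ = begin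
      e 0 * hseq x n + sumℕ (suc k) (λ t → e (suc t) * coord n (suc t))
        ≈⟨ +-cong (*-congʳ e₀≈) (sumℕ-init-last k (λ t → e (suc t) * coord n (suc t))) ⟩
      e-first * hseq x n + (sumℕ k (λ t → e (suc t) * coord n (suc t)) + e (suc k) * coord n (suc k))
        ≈⟨ +-congˡ (+-cong reversed-middle (*-cong e-last≈ (reflexive (coord-last n)))) ⟩
      e-first * hseq x n + (sumℕ k (λ j → ρ j * pow (ι n) j) + e-last * δ₀ n)
        ≈⟨ +-assoc _ _ _ ⟨
      e-first * hseq x n + sumℕ k (λ j → ρ j * pow (ι n) j) + e-last * δ₀ n  ∎
      where
      reversed-middle : sumℕ k (λ t → e (suc t) * coord n (suc t)) ≈ sumℕ k (λ j → ρ j * pow (ι n) j)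
      reversed-middle =
        trans (sumℕ-cong k (λ t t<k → *-cong (e-middle≈ t<k) (reflexive (coord-middle n t<k))))
              (sumℕ-reverse k (λ j → ρ j * pow (ι n) j))

    k∸1+p<k : ∀ {p} → p < k → k ∸ suc p < k
    k∸1+p<k p<k = ℕ.∸-monoʳ-< (s≤s z≤n) p<k

    middle-row : ∀ n r {p} → p < k →
      coord (2 ℕ.* n ℕ.+ toℕ r) (suc p) ≈ sumℕ (suc (suc k)) (λ q → entryA r (suc p) q * coord n q)
    middle-row n r {p} p<k = begin
      coord (2 ℕ.* n ℕ.+ toℕ r) (suc p)            ≡⟨ coord-middle (2 ℕ.* n ℕ.+ toℕ r) p<k ⟩
      pow (ι (2 ℕ.* n ℕ.+ toℕ r)) i               ≈⟨ pow-2n+r n (toℕ r) i k (k∸1+p<k p<k) ⟩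
      sumℕ k (λ j → shiftCoeff (toℕ r) i j * pow (ι n) j)
        ≈⟨ sumℕ-cong k (λ j _ → *-congʳ (sym (a≈shiftCoeff r i j))) ⟩
      sumℕ k (λ j → a r i j * pow (ι n) j)        ≈⟨ zero-ends ⟨
      0# * hseq x n + sumℕ k (λ j → a r i j * pow (ι n) j) + 0# * δ₀ n
        ≈⟨ row-expansion n (entryA r (suc p)) (a r i) (reflexive (entry-middle-first r p<k))
             (λ t<k → reflexive (entry-middle-middle r p<k t<k)) (reflexive (entry-middle-last r p<k)) ⟨
      sumℕ (suc (suc k)) (λ q → entryA r (suc p) q * coord n q)  ∎
      where
      i : ℕ
      i = k ∸ suc p
      zero-ends : ∀ {s} → 0# * hseq x n + s + 0# * δ₀ n ≈ s
      zero-ends = trans (+-cong (trans (+-congʳ (zeroˡ _)) (+-identityˡ _)) (zeroˡ _)) (+-identityʳ _)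

    δ₀-2n+r : ∀ n r → δ₀ (2 ℕ.* n ℕ.+ toℕ r) ≈ iv0 r * δ₀ n
    δ₀-2n+r zero F.zero = sym (*-identityˡ 1#)
    δ₀-2n+r (suc n) F.zero = sym (zeroʳ 1#)
    δ₀-2n+r zero (F.suc F.zero) = sym (zeroˡ 1#)
    δ₀-2n+r (suc n) (F.suc F.zero) = sym (zeroˡ 0#)

    last-row : ∀ n r →
      coord (2 ℕ.* n ℕ.+ toℕ r) (suc k) ≈ sumℕ (suc (suc k)) (λ q → entryA r (suc k) q * coord n q)
    last-row n r = begin
      coord (2 ℕ.* n ℕ.+ toℕ r) (suc k)  ≡⟨ coord-last (2 ℕ.* n ℕ.+ toℕ r) ⟩
      δ₀ (2 ℕ.* n ℕ.+ toℕ r)             ≈⟨ δ₀-2n+r n r ⟩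
      iv0 r * δ₀ n                       ≈⟨ zero-front ⟨
      0# * hseq x n + sumℕ k (λ j → 0# * pow (ι n) j) + iv0 r * δ₀ n
        ≈⟨ row-expansion n (entryA r (suc k)) (λ _ → 0#) (reflexive (entry-last-first r))
             (λ t<k → reflexive (entry-last-middle r t<k)) (reflexive (entry-last-last r)) ⟨
      sumℕ (suc (suc k)) (λ q → entryA r (suc k) q * coord n q)  ∎
      where
      zero-front : ∀ {s} → 0# * hseq x n + sumℕ k (λ j → 0# * pow (ι n) j) + s ≈ s
      zero-front = trans (+-congʳ (trans (+-cong (zeroˡ _) (sumℕ-zero k (λ j _ → zeroˡ _))) (+-identityʳ 0#)))
                         (+-identityˡ _)

    last-column≈0 : d F.zero ≈ 0# → d (F.suc F.zero) ≈ 0# →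
                    ∀ r p → A r (F.inject₁ p) (F.fromℕ (suc k)) ≈ 0#
    last-column≈0 d₀≈0 d₁≈0 r p rewrite FP.toℕ-inject₁ p | FP.toℕ-fromℕ (suc k) =
      column (toℕ p) (FP.toℕ<n p)
      where
      d≈0 : ∀ r → d r ≈ 0#
      d≈0 F.zero = d₀≈0
      d≈0 (F.suc F.zero) = d₁≈0
      column : ∀ q → q < suc k → entryA r q (suc k) ≈ 0#
      column zero _ = trans (reflexive (entry-first-last r)) (d≈0 r)
      column (suc q) (s≤s q<k) = reflexive (entry-middle-last r q<k)

    d₁ : Carrier
    d₁ = d (F.suc F.zero)

    d₀≈g₀−d₁ : d F.zero ≈ g 0 − d₁
    d₀≈g₀−d₁ = sym (trans (+-congˡ (⁻¹-anti-homo‿- (g 1) ((1# − β) * x 1))) (+-comm (g 0) _))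

    module _ (x0 : x 0 ≈ 0#) (rec : ∀ n → n ≥ 2 → x n ≈ α * x ⌊ n /2⌋ + β * x ⌈ n /2⌉ + g n) where

      *x₀≈0 : ∀ c → c * x 0 ≈ 0#
      *x₀≈0 c = trans (*-congˡ x0) (zeroʳ c)

      x-even : ∀ n → x (2 ℕ.* n ℕ.+ 0) + g 0 * δ₀ n ≈ α * x n + β * x n + g (2 ℕ.* n ℕ.+ 0)
      x-even zero = begin
        x 0 + g 0 * 1#           ≈⟨ +-cong x0 (*-identityʳ _) ⟩
        0# + g 0                 ≈⟨ +-congʳ (trans (+-cong (*x₀≈0 α) (*x₀≈0 β)) (+-identityʳ 0#)) ⟨
        α * x 0 + β * x 0 + g 0  ∎
      x-even (suc n) = begin
        x m + g 0 * 0#           ≈⟨ trans (+-congˡ (zeroʳ _)) (+-identityʳ _) ⟩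
        x m                      ≈⟨ rec m (2≤2[1+n]+r n 0) ⟩
        α * x ⌊ m /2⌋ + β * x ⌈ m /2⌉ + g m
          ≡⟨ ≡.cong₂ (λ p q → α * x p + β * x q + g m) (⌊2n+0/2⌋≡n (suc n)) (⌈2n+0/2⌉≡n (suc n)) ⟩
        α * x (suc n) + β * x (suc n) + g m  ∎
        where
        m : ℕ
        m = 2 ℕ.* suc n ℕ.+ 0

      x-odd : ∀ n → x (2 ℕ.* n ℕ.+ 1) + d₁ * δ₀ n ≈ α * x n + β * x (suc n) + g (2 ℕ.* n ℕ.+ 1)
      x-odd zero = begin
        x 1 + d₁ * 1#                ≈⟨ +-cong x₁≈y+βx₁ (*-identityʳ d₁) ⟩
        (y + β * x 1) + (g 1 − y)    ≈⟨ +-congˡ (+-comm (g 1) (- y)) ⟩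
        (y + β * x 1) + (- y + g 1)  ≈⟨ interchange y (β * x 1) (- y) (g 1) ⟩
        (y − y) + (β * x 1 + g 1)    ≈⟨ trans (+-congʳ (-‿inverseʳ y)) (+-identityˡ _) ⟩
        β * x 1 + g 1                ≈⟨ +-congʳ (trans (+-congʳ (*x₀≈0 α)) (+-identityˡ _)) ⟨
        α * x 0 + β * x 1 + g 1      ∎
        where
        y : Carrier
        y = (1# − β) * x 1
        x₁≈y+βx₁ : x 1 ≈ y + β * x 1
        x₁≈y+βx₁ = sym (begin
          (1# − β) * x 1 + β * x 1  ≈⟨ distribʳ (x 1) (1# − β) β ⟨
          ((1# − β) + β) * x 1      ≈⟨ *-congʳ (//-rightDividesˡ β 1#) ⟩
          1# * x 1                  ≈⟨ *-identityˡ (x 1) ⟩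
          x 1                       ∎)
      x-odd (suc n) = begin
        x m + d₁ * 0#                ≈⟨ trans (+-congˡ (zeroʳ _)) (+-identityʳ _) ⟩
        x m                          ≈⟨ rec m (2≤2[1+n]+r n 1) ⟩
        α * x ⌊ m /2⌋ + β * x ⌈ m /2⌉ + g m
          ≡⟨ ≡.cong₂ (λ p q → α * x p + β * x q + g m) (⌊2n+1/2⌋≡n (suc n)) (⌈2n+1/2⌉≡1+n (suc n)) ⟩
        α * x (suc n) + β * x (suc (suc n)) + g m  ∎
        where
        m : ℕ
        m = 2 ℕ.* suc n ℕ.+ 1

      x-even-next : ∀ n →
        x (suc (2 ℕ.* n ℕ.+ 1)) + g 0 * 0# ≈ α * x (suc n) + β * x (suc n) + g (2 ℕ.* n ℕ.+ 2)
      x-even-next n = ≡.subst₂ (λ p q → x p + g 0 * 0# ≈ α * x (suc n) + β * x (suc n) + g q)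
        (≡.sym (1+[2n+1]≡2[1+n]+0 n)) (≡.sym (2n+2≡2[1+n]+0 n)) (x-even (suc n))

      first-row : ∀ n r → hseq x (2 ℕ.* n ℕ.+ toℕ r) ≈
                          μ r * hseq x n + sumℕ k (λ j → b r j * pow (ι n) j) + d r * δ₀ n
      first-row n F.zero =
        trans (reflexive (≡.cong (λ m → x m − x (2 ℕ.* n ℕ.+ 0)) (≡.sym (ℕ.+-suc (2 ℕ.* n) 0))))
              (trans (−-corrected (x-odd n) (x-even n)) (+-cong right-sides corrections))
        where
        right-sides : (α * x n + β * x (suc n) + g (2 ℕ.* n ℕ.+ 1)) −
                      (α * x n + β * x n + g (2 ℕ.* n ℕ.+ 0)) ≈
                      β * hseq x n + sumℕ k (λ j → b F.zero j * pow (ι n) j)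
        right-sides = trans (+-−-interchange _ _ _ _)
          (+-cong (trans (+-−-cancelˡ _ _ _) (sym (x[y-z]≈xy-xz β (x (suc n)) (x n))))
                  (g-difference n F.zero))
        corrections : g 0 * δ₀ n − d₁ * δ₀ n ≈ d F.zero * δ₀ n
        corrections = trans (sym ([y-z]x≈yx-zx (δ₀ n) (g 0) d₁)) (*-congʳ (sym d₀≈g₀−d₁))
      first-row n (F.suc F.zero) =
        trans (−-corrected (x-even-next n) (x-odd n)) (+-cong right-sides corrections)
        where
        right-sides : (α * x (suc n) + β * x (suc n) + g (2 ℕ.* n ℕ.+ 2)) −
                      (α * x n + β * x (suc n) + g (2 ℕ.* n ℕ.+ 1)) ≈
                      α * hseq x n + sumℕ k (λ j → b (F.suc F.zero) j * pow (ι n) j)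
        right-sides = trans (+-−-interchange _ _ _ _)
          (+-cong (trans (+-−-cancelʳ _ _ _) (sym (x[y-z]≈xy-xz α (x (suc n)) (x n))))
                  (g-difference n (F.suc F.zero)))
        corrections : d₁ * δ₀ n − g 0 * 0# ≈ d₁ * δ₀ n
        corrections = trans (+-congˡ (trans (-‿cong (zeroʳ _)) -0#≈0#)) (+-identityʳ _)

      coord-step : ∀ n r {p} → Position p →
        coord (2 ℕ.* n ℕ.+ toℕ r) p ≈ sumℕ (suc (suc k)) (λ q → entryA r p q * coord n q)
      coord-step n r first = trans (first-row n r)
        (sym (row-expansion n (entryA r 0) (b r) refl
               (λ t<k → reflexive (entry-first-middle r t<k)) (reflexive (entry-first-last r))))
      coord-step n r (middle p<k) = middle-row n r p<k
      coord-step n r last = last-row n r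

      initial : state 0 ≋ w
      initial p with toℕ p | FP.toℕ<n p
      ... | zero | _ = trans (+-congˡ (trans (-‿cong x0) -0#≈0#)) (+-identityʳ _)
      ... | suc m | s≤s 1+m≤1+k with suc m ≟ k
      ...   | yes 1+m≡k with suc m ≟ suc k
      ...     | yes 1+m≡1+k = contradiction (≡.trans (≡.sym 1+m≡1+k) 1+m≡k) ℕ.1+n≢n
      ...     | no _ =
        reflexive (≡.cong (pow 0#) (≡.trans (≡.cong (_∸ suc m) (≡.sym 1+m≡k)) (ℕ.n∸n≡0 (suc m))))
      initial p | suc m | s≤s 1+m≤1+k | no 1+m≢k with suc m ≟ suc k
      ...     | yes _ = refl
      ...     | no 1+m≢1+k = pow-0# (ℕ.m<n⇒0<n∸m 1+m<k)
        where
        1+m<k : suc m < k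
        1+m<k = ℕ.≤∧≢⇒< (ℕ.≤-pred (ℕ.≤∧≢⇒< 1+m≤1+k 1+m≢1+k)) 1+m≢k

      linear-representation : IsLinRep2 u A w (hseq x)
      linear-representation = state , initial , output , recurrence
        where
        output : ∀ n → hseq x n ≈ u · state n
        output n = sym (·-head u (state n) refl (λ _ → refl))
        recurrence : ∀ n r → state (2 ℕ.* n ℕ.+ toℕ r) ≋ (A r ⊛ state n)
        recurrence n r p = trans (coord-step n r (position (FP.toℕ<n p)))
          (reflexive (≡.sym (sumFin-toℕ (suc (suc k)) (λ q → entryA r (toℕ p) q * coord n q))))

-- The hypothesis c_k ≠ 0 only fixes the degree k; the proof does not need it.
lemma3p3 : ∀ {c ℓ : Level} (R : CommutativeRing c ℓ) →
    let open CommutativeRing R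
        open Defs.Setup R
    in (k : ℕ) (α β : Carrier) (cs : ℕ → Carrier) → ¬ (cs k ≈ 0#) →
       (x : ℕ → Carrier) → x 0 ≈ 0# →
       (∀ n → n ≥ 2 → x n ≈ α * x ⌊ n /2⌋ + β * x ⌈ n /2⌉ + poly k cs n) →
       let open Data3p3 k α β cs (x 1)
       in IsLinRep2 u A w (hseq x)
          × (d F.zero ≈ 0# → d (F.suc F.zero) ≈ 0# → IsLinRep2 u' A' w' (hseq x))
lemma3p3 R k α β cs _ x x0 rec = representation , reduced
  where
  open CommutativeRing R using (_≈_; 0#; refl)
  open Setup R
  open Data3p3 k α β cs (x 1)
  representation : IsLinRep2 u A w (hseq x)
  representation = linear-representation R k α β cs x x0 rec
  reduced : d F.zero ≈ 0# → d (F.suc F.zero) ≈ 0# → IsLinRep2 u' A' w' (hseq x)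
  reduced d₀≈0 d₁≈0 =
    IsLinRep2-dropLast R {u = u} {A = A} representation refl (last-column≈0 R k α β cs x d₀≈0 d₁≈0)
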